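{- Let $H$ be a graph, possibly with loops, and let $G$ be an $H$-colored complete graph such that for every $x\in V(G)$ the graph $G_x$ is a complete $k_x$-partite graph for some $k_x\in\mathbb{N}$. Let $A$ be a nonempty subset of $V(G)$ and $v\in V(G)\setminus A$, and let $D=G[A]$. If $A$ has the $H$-dependence property with respect to $v$, then there exists a vertex $a\in A$ such that (1) $l_a^D\le \frac{|A|+1}{2}$, and (2) if $|A|\ge 2$, then $a$ is an obstruction of the walk $(v,a,a')$ for some $a'\in N_D(a)$.
   Context: An $H$-coloring of $G$ is a function $c:E(G)\to V(H)$. For a vertex $x$ of $G$, $G_x$ is the graph whose vertex set is the set of edges of $G$ incident with $x$, two distinct such edges $a,b$ being adjacent iff $c(a)c(b)\in E(H)$; when $G_x$ is complete $k_x$-partite, let $\{P^x_1,\dots,P^x_{k_x}\}$ be its partition into (nonempty) independent sets. For the induced subgraph $D$ and $a\in V(D)$, $D_a$ is defined analogously (vertex set: edges of $D$ incident with $a$), and $l_a^D$ denotes the number of indices $i$ with $P_i^a\cap V(D_a)\neq\emptyset$ (these nonempty intersections form the partition of $D_a$ as a complete multipartite graph). For a walk $(x_1,\dots,x_m)$ and $2\le i\le m-1$, $x_i$ is an obstruction of the walk if $c(x_{i-1}x_i)c(x_ix_{i+1})\notin E(H)$. A set $A\subseteq V(G)$ has the $H$-dependence property with respect to $v\in V(G)\setminus A$ if for every two distinct $a,a'\in A$, $a$ is an obstruction of the walk $(v,a,a')$ or $a'$ is an obstruction of the walk $(a,a',v)$. -}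

module Defs where

open import Level using (Level; suc; _⊔_)
open import Data.Nat using (ℕ; _≤_; _+_; _*_)
open import Data.Fin using (Fin; _≟_)
open import Data.Fin.Subset using (Subset; _∈_; ∣_∣)
open import Data.Fin.Subset.Properties using (_∈?_)
open import Data.Fin.Properties using (any?)
open import Data.Vec using (tabulate)
open import Data.Sum using (_⊎_)
open import Data.Product using (Σ; ∃; _×_; _,_)
open import Relation.Nullary using (¬_; ¬?; does)
open import Relation.Nullary.Decidable using (_×-dec_)
open import Relation.Binary.PropositionalEquality using (_≡_; _≢_)

record Graph : Set₁ where
  field
    V   : Set
    E   : V → V → Set
    sym : ∀ {u w} → E u w → E w u
open Graph public

-- An H-coloring of the complete graph K_n on vertex set Fin n:
-- c x y is the color of the edge xy (x ≢ y); the value for x ≡ y is irrelevant.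
-- Symmetry c x y ≡ c y x is assumed separately (edges are unordered).
Coloring : Graph → ℕ → Set
Coloring H n = Fin n → Fin n → V H

-- G_x (vertices: the edges xy, identified with y ≢ x; xy ~ xz iff c(xy)c(xz) ∈ E(H))
-- is complete k-partite with partition given by the class map p : the parts
-- P_i = { xy : p y ≡ i } are nonempty, and distinct xy, xz are adjacent
-- iff they lie in different parts.
record IsCompleteMultipartite (H : Graph) {n : ℕ} (c : Coloring H n)
         (x : Fin n) (k : ℕ) (p : Fin n → Fin k) : Set where
  field
    nonempty-parts : ∀ (i : Fin k) → ∃ λ y → y ≢ x × p y ≡ i
    adj⇒diff : ∀ y z → y ≢ x → z ≢ x → y ≢ z → E H (c x y) (c x z) → p y ≢ p z
    diff⇒adj : ∀ y z → y ≢ x → z ≢ x → y ≢ z → p y ≢ p z → E H (c x y) (c x z)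

Obstruction : (H : Graph) {n : ℕ} (c : Coloring H n) (x₁ x₂ x₃ : Fin n) → Set
Obstruction H c x₁ x₂ x₃ = ¬ E H (c x₁ x₂) (c x₂ x₃)

HDependent : (H : Graph) {n : ℕ} (c : Coloring H n) (A : Subset n) (v : Fin n) → Set
HDependent H c A v = ∀ a a' → a ∈ A → a' ∈ A → a ≢ a' →
  Obstruction H c v a a' ⊎ Obstruction H c a a' v

-- The set of indices i with P_i^a ∩ V(D_a) ≠ ∅, where D = G[A] and
-- V(D_a) = { ab : b ∈ A, b ≢ a }.
usedParts : {n k : ℕ} (p : Fin n → Fin k) (A : Subset n) (a : Fin n) → Subset k
usedParts p A a = tabulate λ i →
  does (any? λ b → (b ∈? A) ×-dec ((¬? (b ≟ a)) ×-dec (p b ≟ i)))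

l^D : {n k : ℕ} (p : Fin n → Fin k) (A : Subset n) (a : Fin n) → ℕ
l^D p A a = ∣ usedParts p A a ∣

-- Say that a ∈ A dominates b ∈ A ∖ {a} when ab lies in the part of G_a containing av, i.e. when a
-- is an obstruction of the walk (v, a, b). The H-dependence property says that of two distinct
-- vertices of A one dominates the other, so counting ordered pairs of A yields a vertex a
-- dominating at least (|A| − 1)/2 others. Every part of D_a except the one containing av holds
-- a vertex that a does not dominate, and there are at most (|A| − 1)/2 of these, whence
-- l_a^D ≤ (|A| + 1)/2; when |A| ≥ 2, a dominates some a', which is (2).
module Submission where

open import Defs hiding (sym)
open import Data.Bool using (Bool; true; false; _∧_; not; T)
open import Data.Bool.Properties using (T-≡; T-not-≡; T-∧)
open import Data.Empty using (⊥-elim)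
open import Data.Fin using (Fin; zero; suc)
open import Data.Fin.Properties using (_≟_; any?)
open import Data.Fin.Subset using (Subset; _∈_; _∉_; ∣_∣; Nonempty)
open import Data.Fin.Subset.Properties using (_∈?_)
open import Data.Nat using (ℕ; zero; suc; _≤_; _<_; _+_; _*_; z≤n; s≤s; _≤?_)
open import Data.Nat.Properties hiding (_≟_)
open import Algebra.Properties.Semiring.Sum +-*-semiring
  using (sum; sum-syntax; ∑-distrib-+; ∑-comm; sum-cong-≗; sum-replicate-zero; *-distribʳ-sum)
open import Data.Nat.Tactic.RingSolver using (solve-∀)
open import Data.Product using (∃; _×_; _,_; proj₁)
open import Data.Sum using (_⊎_; inj₁; inj₂)
open import Data.Unit using (tt)
open import Data.Vec using (lookup; tabulate)
open import Data.Vec.Properties using (tabulate∘lookup; []=⇒lookup; lookup⇒[]=)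
open import Function using (_∘_; case_of_; Equivalence)
open import Relation.Nullary using (Dec; yes; no; does; ¬_; ¬?; contradiction)
open import Relation.Nullary.Decidable using (T?; _×-dec_; dec-true; dec-false; decidable-stable)
open import Relation.Binary.PropositionalEquality

open Equivalence using (to; from)

T-does⁺ : ∀ {P : Set} (P? : Dec P) → P → T (does P?)
T-does⁺ P? p = from T-≡ (dec-true P? p)

T-does⁻ : ∀ {P : Set} (P? : Dec P) → T (does P?) → P
T-does⁻ (yes p) _ = p

T-not-does⁺ : ∀ {P : Set} (P? : Dec P) → ¬ P → T (not (does P?))
T-not-does⁺ P? ¬p = from T-not-≡ (dec-false P? ¬p)

T-not-does⁻ : ∀ {P : Set} (P? : Dec P) → T (not (does P?)) → ¬ P
T-not-does⁻ (no ¬p) _ = ¬p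

∑-mono-≤ : ∀ {n} {f g : Fin n → ℕ} → (∀ i → f i ≤ g i) → sum f ≤ sum g
∑-mono-≤ {zero}  _   = z≤n
∑-mono-≤ {suc n} f≤g = +-mono-≤ (f≤g zero) (∑-mono-≤ (f≤g ∘ suc))

∑-mono-< : ∀ {n} {f g : Fin n → ℕ} → (∀ i → f i ≤ g i) → ∀ j → f j < g j → sum f < sum g
∑-mono-< f≤g zero    fj<gj = +-mono-<-≤ fj<gj (∑-mono-≤ (f≤g ∘ suc))
∑-mono-< f≤g (suc j) fj<gj = +-mono-≤-< (f≤g zero) (∑-mono-< (f≤g ∘ suc) j fj<gj)

term≤∑ : ∀ {n} (f : Fin n → ℕ) i → f i ≤ sum f
term≤∑ f zero    = m≤m+n (f zero) _
term≤∑ f (suc i) = ≤-trans (term≤∑ (f ∘ suc) i) (m≤n+m _ (f zero))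

∑∑-transpose-+ : ∀ {n} (F G : Fin n → Fin n → ℕ)
  → ∑[ i < n ] ∑[ j < n ] (F i j + G j i) ≡ ∑[ i < n ] ∑[ j < n ] (F i j + G i j)
∑∑-transpose-+ {n} F G = begin
  ∑[ i < n ] ∑[ j < n ] (F i j + G j i)            ≡⟨ ∑∑-distrib F (λ i j → G j i) ⟩
  ∑[ i < n ] sum (F i) + ∑[ i < n ] ∑[ j < n ] G j i ≡⟨ cong (∑[ i < n ] sum (F i) +_) (∑-comm G) ⟨
  ∑[ i < n ] sum (F i) + ∑[ i < n ] sum (G i)        ≡⟨ ∑∑-distrib F G ⟨
  ∑[ i < n ] ∑[ j < n ] (F i j + G i j)            ∎
  where
  open ≡-Reasoning
  ∑∑-distrib : ∀ (F G : Fin n → Fin n → ℕ)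
    → ∑[ i < n ] ∑[ j < n ] (F i j + G i j) ≡ ∑[ i < n ] sum (F i) + ∑[ i < n ] sum (G i)
  ∑∑-distrib F G =
    trans (sum-cong-≗ (λ i → ∑-distrib-+ (F i) (G i))) (∑-distrib-+ (sum ∘ F) (sum ∘ G))

χ : Bool → ℕ
χ true  = 1
χ false = 0

1≤χ+χ+χ : ∀ x y z → T x ⊎ T y ⊎ T z → 1 ≤ χ x + χ y + χ z
1≤χ+χ+χ true  _     _     _                = s≤s z≤n
1≤χ+χ+χ false true  _     _                = s≤s z≤n
1≤χ+χ+χ false false true  _                = s≤s z≤n
1≤χ+χ+χ false false false (inj₂ (inj₁ ()))
1≤χ+χ+χ false false false (inj₂ (inj₂ ()))

χ*-monoʳ-≤ : ∀ x {y z} → (T x → y ≤ z) → χ x * y ≤ χ x * z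
χ*-monoʳ-≤ true  y≤z = +-monoˡ-≤ 0 (y≤z tt)
χ*-monoʳ-≤ false _   = z≤n

χ*-monoʳ-< : ∀ x {y z} → T x → y < z → χ x * y < χ x * z
χ*-monoʳ-< true _ y<z = +-monoˡ-< 0 y<z

χ-split : ∀ x e s → (T e → T x) → χ x ≡ χ (x ∧ (not e ∧ s)) + χ (x ∧ (not e ∧ not s)) + χ e
χ-split true  true  _     _   = refl
χ-split true  false true  _   = refl
χ-split true  false false _   = refl
χ-split false false _     _   = refl
χ-split false true  _     e⇒x = ⊥-elim (e⇒x tt)

χ≤χ+χ∧not : ∀ x e → χ x ≤ χ e + χ (x ∧ not e)
χ≤χ+χ∧not true  true  = ≤-refl
χ≤χ+χ∧not true  false = ≤-refl
χ≤χ+χ∧not false _     = z≤n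

count : ∀ {n} → (Fin n → Bool) → ℕ
count f = sum (χ ∘ f)

∣tabulate∣≡count : ∀ {n} (f : Fin n → Bool) → ∣ tabulate f ∣ ≡ count f
∣tabulate∣≡count {zero}  f = refl
∣tabulate∣≡count {suc n} f with f zero
... | true  = cong suc (∣tabulate∣≡count (f ∘ suc))
... | false = ∣tabulate∣≡count (f ∘ suc)

∣_∣≡count : ∀ {n} (A : Subset n) → ∣ A ∣ ≡ count (lookup A)
∣ A ∣≡count = trans (cong ∣_∣ (sym (tabulate∘lookup A))) (∣tabulate∣≡count (lookup A))

∈⇒T : ∀ {n} {A : Subset n} {a} → a ∈ A → T (lookup A a)
∈⇒T a∈A = from T-≡ ([]=⇒lookup a∈A)

T⇒∈ : ∀ {n} {A : Subset n} {a} → T (lookup A a) → a ∈ A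
T⇒∈ {A = A} {a} Aa = lookup⇒[]= a A (to T-≡ Aa)

count-false : ∀ n → count {n} (λ _ → false) ≡ 0
count-false = sum-replicate-zero

count-∧ˡ : ∀ {n} x (f : Fin n → Bool) → count (λ i → x ∧ f i) ≡ χ x * count f
count-∧ˡ     true  f = sym (+-identityʳ (count f))
count-∧ˡ {n} false f = count-false n

count-≟ : ∀ {n} (j : Fin n) → count (λ i → does (i ≟ j)) ≡ 1
count-≟ {suc n} zero    = cong suc (count-false n)
count-≟         (suc j) = count-≟ j

count-pos : ∀ {n} (f : Fin n → Bool) {i} → T (f i) → 1 ≤ count f
count-pos f {i} fi = ≤-trans (χ-pos (f i) fi) (term≤∑ (χ ∘ f) i)
  where
  χ-pos : ∀ x → T x → 1 ≤ χ x
  χ-pos true _ = ≤-refl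

count-witness : ∀ {n} (f : Fin n → Bool) → 1 ≤ count f → ∃ λ i → T (f i)
count-witness {suc n} f 1≤ with f zero in f₀
... | true  = zero , from T-≡ f₀
... | false = let i , fi = count-witness (f ∘ suc) 1≤ in suc i , fi

-- The fibres of B over the points of S are nonempty and pairwise disjoint.
count-image-≤ : ∀ {n k} (f : Fin n → Fin k) (S : Fin k → Bool) (B : Fin n → Bool)
  → (∀ i → T (S i) → ∃ λ b → T (B b) × f b ≡ i)
  → count S ≤ count B
count-image-≤ {n} {k} f S B covered = begin
  count S                        ≤⟨ ∑-mono-≤ fibre-nonempty ⟩
  ∑[ i < k ] count (fibre i)     ≡⟨ ∑-comm (λ i b → χ (fibre i b)) ⟩
  ∑[ b < n ] count (λ i → fibre i b) ≡⟨ sum-cong-≗ fibres-disjoint ⟩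
  count B                        ∎
  where
  open ≤-Reasoning
  fibre : Fin k → Fin n → Bool
  fibre i b = B b ∧ does (i ≟ f b)
  fibre-nonempty : ∀ i → χ (S i) ≤ count (fibre i)
  fibre-nonempty i with S i | covered i
  ... | false | _     = z≤n
  ... | true  | cover with cover tt
  ...   | b , Bb , fb≡i = count-pos (fibre i) (from T-∧ (Bb , T-does⁺ (i ≟ f b) (sym fb≡i)))
  fibres-disjoint : ∀ b → count (λ i → fibre i b) ≡ χ (B b)
  fibres-disjoint b = begin-equality
    count (λ i → fibre i b)                 ≡⟨ count-∧ˡ (B b) (λ i → does (i ≟ f b)) ⟩
    χ (B b) * count (λ i → does (i ≟ f b))  ≡⟨ cong (χ (B b) *_) (count-≟ (f b)) ⟩
    χ (B b) * 1                             ≡⟨ *-identityʳ (χ (B b)) ⟩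
    χ (B b)                                 ∎

module _ {n} (A : Fin n → Bool) (R : Fin n → Fin n → Bool)
  (semicomplete : ∀ a b → T (A a) → T (A b) → a ≢ b → T (R a b) ⊎ T (R b a)) where

  private
    outdegree : Fin n → ℕ
    outdegree a = count (λ b → A b ∧ R a b)

    loop arc : Fin n → Fin n → ℕ
    loop a b = χ (A a ∧ does (b ≟ a))
    arc  a b = χ (A a ∧ (A b ∧ R a b))

    pair-covered : ∀ a b → χ (A a ∧ A b) ≤ loop a b + arc a b + arc b a
    pair-covered a b with A a in Aa | A b in Ab
    ... | false | _     = z≤n
    ... | true  | false = z≤n
    ... | true  | true  = 1≤χ+χ+χ _ _ _ (loop-or-arc (b ≟ a))
      where
      loop-or-arc : ∀ b≟a → T (does b≟a) ⊎ T (R a b) ⊎ T (R b a)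
      loop-or-arc (yes _)  = inj₁ tt
      loop-or-arc (no b≢a) = inj₂ (semicomplete a b (from T-≡ Aa) (from T-≡ Ab) (b≢a ∘ sym))

    row-sum : ∀ a → ∑[ b < n ] (loop a b + arc a b + arc a b) ≡ χ (A a) * (2 * outdegree a + 1)
    row-sum a = begin
      ∑[ b < n ] (loop a b + arc a b + arc a b)
        ≡⟨ ∑-distrib-+ (λ b → loop a b + arc a b) (arc a) ⟩
      ∑[ b < n ] (loop a b + arc a b) + sum (arc a)
        ≡⟨ cong (_+ sum (arc a)) (∑-distrib-+ (loop a) (arc a)) ⟩
      sum (loop a) + sum (arc a) + sum (arc a)
        ≡⟨ cong₂ (λ x y → x + y + y) (count-∧ˡ (A a) (λ b → does (b ≟ a)))
                                      (count-∧ˡ (A a) (λ b → A b ∧ R a b)) ⟩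
      χ (A a) * count (λ b → does (b ≟ a)) + χ (A a) * outdegree a + χ (A a) * outdegree a
        ≡⟨ cong (λ x → χ (A a) * x + χ (A a) * outdegree a + χ (A a) * outdegree a) (count-≟ a) ⟩
      χ (A a) * 1 + χ (A a) * outdegree a + χ (A a) * outdegree a
        ≡⟨ factor (χ (A a)) (outdegree a) ⟩
      χ (A a) * (2 * outdegree a + 1) ∎
      where
      open ≡-Reasoning
      factor : ∀ x d → x * 1 + x * d + x * d ≡ x * (2 * d + 1)
      factor = solve-∀

    -- Every ordered pair of A is covered: a diagonal pair by a loop, any other pair by an arc.
    ∣A∣²≤∑-outdegree : count A * count A ≤ ∑[ a < n ] (χ (A a) * (2 * outdegree a + 1))
    ∣A∣²≤∑-outdegree = begin
      count A * count A
        ≡⟨ *-distribʳ-sum (count A) (χ ∘ A) ⟩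
      ∑[ a < n ] (χ (A a) * count A)
        ≡⟨ sum-cong-≗ (λ a → sym (count-∧ˡ (A a) A)) ⟩
      ∑[ a < n ] count (λ b → A a ∧ A b)
        ≤⟨ ∑-mono-≤ (λ a → ∑-mono-≤ (pair-covered a)) ⟩
      ∑[ a < n ] ∑[ b < n ] (loop a b + arc a b + arc b a)
        ≡⟨ ∑∑-transpose-+ (λ a b → loop a b + arc a b) arc ⟩
      ∑[ a < n ] ∑[ b < n ] (loop a b + arc a b + arc a b)
        ≡⟨ sum-cong-≗ row-sum ⟩
      ∑[ a < n ] (χ (A a) * (2 * outdegree a + 1)) ∎
      where open ≤-Reasoning

  semicomplete⇒large-outdegree : ∃ (T ∘ A)
    → ∃ λ a → T (A a) × count A ≤ 2 * count (λ b → A b ∧ R a b) + 1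
  semicomplete⇒large-outdegree (a₀ , Aa₀)
    with any? (λ a → T? (A a) ×-dec (count A ≤? 2 * outdegree a + 1))
  ... | yes large = large
  ... | no  none  = ⊥-elim (<-irrefl refl (begin-strict
    count A * count A                            ≤⟨ ∣A∣²≤∑-outdegree ⟩
    ∑[ a < n ] (χ (A a) * (2 * outdegree a + 1)) <⟨ ∑-mono-< (λ a → χ*-monoʳ-≤ (A a) (<⇒≤ ∘ small a))
                                                             a₀ (χ*-monoʳ-< (A a₀) Aa₀ (small a₀ Aa₀)) ⟩
    ∑[ a < n ] (χ (A a) * count A)               ≡⟨ *-distribʳ-sum (count A) (χ ∘ A) ⟨
    count A * count A                            ∎))
    where
    open ≤-Reasoning
    small : ∀ a → T (A a) → 2 * outdegree a + 1 < count A
    small a Aa = ≰⇒> (λ large → none (a , Aa , large))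

nonadjacent⇒samePart : ∀ {H : Graph} {n} {c : Coloring H n} {x k} {p : Fin n → Fin k}
  → IsCompleteMultipartite H c x k p
  → ∀ {y z} → y ≢ x → z ≢ x → y ≢ z → ¬ E H (c x y) (c x z) → p y ≡ p z
nonadjacent⇒samePart {p = p} G-x {y} {z} y≢x z≢x y≢z ¬adj =
  decidable-stable (p y ≟ p z) (¬adj ∘ IsCompleteMultipartite.diff⇒adj G-x y z y≢x z≢x y≢z)

module PartOfV (H : Graph) {n} (c : Coloring H n) (c-sym : ∀ x y → c x y ≡ c y x)
  {k : Fin n → ℕ} {p : (x : Fin n) → Fin n → Fin (k x)}
  (multipartite : ∀ x → IsCompleteMultipartite H c x (k x) (p x))
  (A : Subset n) (v : Fin n) (v∉A : v ∉ A) where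

  private
    Aᵇ : Fin n → Bool
    Aᵇ = lookup A

    ∈⇒≢v : ∀ {a} → a ∈ A → a ≢ v
    ∈⇒≢v a∈A refl = v∉A a∈A

  inPartOfV outsidePartOfV : Fin n → Fin n → Bool
  inPartOfV      a b = not (does (b ≟ a)) ∧ does (p a b ≟ p a v)
  outsidePartOfV a b = not (does (b ≟ a)) ∧ not (does (p a b ≟ p a v))

  #inPartOfV #outsidePartOfV : Fin n → ℕ
  #inPartOfV      a = count (λ b → Aᵇ b ∧ inPartOfV a b)
  #outsidePartOfV a = count (λ b → Aᵇ b ∧ outsidePartOfV a b)

  inPartOfV⁺ : ∀ {a b} → b ≢ a → p a b ≡ p a v → T (inPartOfV a b)
  inPartOfV⁺ {a} {b} b≢a same = from T-∧ (T-not-does⁺ (b ≟ a) b≢a , T-does⁺ (p a b ≟ p a v) same)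

  inPartOfV⁻ : ∀ {a b} → T (inPartOfV a b) → b ≢ a × p a b ≡ p a v
  inPartOfV⁻ {a} {b} ab = let b≢a , same = to T-∧ ab in
    T-not-does⁻ (b ≟ a) b≢a , T-does⁻ (p a b ≟ p a v) same

  inPartOfV⇒obstruction : ∀ {a b} → a ∈ A → b ∈ A → T (inPartOfV a b) → Obstruction H c v a b
  inPartOfV⇒obstruction {a} {b} a∈A b∈A ab adj with inPartOfV⁻ ab
  ... | b≢a , same =
    IsCompleteMultipartite.adj⇒diff (multipartite a) b v b≢a (∈⇒≢v a∈A ∘ sym) (∈⇒≢v b∈A)
      (Graph.sym H (subst (λ e → E H e (c a b)) (c-sym v a) adj)) same

  inPartOfV-semicomplete : HDependent H c A v
    → ∀ a b → T (Aᵇ a) → T (Aᵇ b) → a ≢ b → T (inPartOfV a b) ⊎ T (inPartOfV b a)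
  inPartOfV-semicomplete dependent a b Aa Ab a≢b with dependent a b (T⇒∈ Aa) (T⇒∈ Ab) a≢b
  ... | inj₁ a-obstructs = inj₁ (inPartOfV⁺ (a≢b ∘ sym) (nonadjacent⇒samePart (multipartite a)
          (a≢b ∘ sym) (∈⇒≢v (T⇒∈ Aa) ∘ sym) (∈⇒≢v (T⇒∈ Ab))
          (a-obstructs ∘ subst (λ e → E H e (c a b)) (c-sym a v) ∘ Graph.sym H)))
  ... | inj₂ b-obstructs = inj₂ (inPartOfV⁺ a≢b (nonadjacent⇒samePart (multipartite b)
          a≢b (∈⇒≢v (T⇒∈ Ab) ∘ sym) (∈⇒≢v (T⇒∈ Aa))
          (b-obstructs ∘ subst (λ e → E H e (c b v)) (c-sym b a))))

  large-#inPartOfV : HDependent H c A v → Nonempty A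
    → ∃ λ a → a ∈ A × ∣ A ∣ ≤ 2 * #inPartOfV a + 1
  large-#inPartOfV dependent (a₀ , a₀∈A)
    with semicomplete⇒large-outdegree Aᵇ inPartOfV (inPartOfV-semicomplete dependent) (a₀ , ∈⇒T a₀∈A)
  ... | a , Aa , large = a , T⇒∈ Aa , subst (_≤ 2 * #inPartOfV a + 1) (sym ∣ A ∣≡count) large

  #inPartOfV+#outsidePartOfV : ∀ {a} → a ∈ A → #inPartOfV a + #outsidePartOfV a + 1 ≡ ∣ A ∣
  #inPartOfV+#outsidePartOfV {a} a∈A = begin
    count in-part + count outside-part + 1
      ≡⟨ cong (count in-part + count outside-part +_) (count-≟ a) ⟨
    count in-part + count outside-part + count (λ b → does (b ≟ a))
      ≡⟨ cong (_+ count (λ b → does (b ≟ a))) (∑-distrib-+ (χ ∘ in-part) (χ ∘ outside-part)) ⟨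
    ∑[ b < n ] (χ (in-part b) + χ (outside-part b)) + count (λ b → does (b ≟ a))
      ≡⟨ ∑-distrib-+ (λ b → χ (in-part b) + χ (outside-part b)) (λ b → χ (does (b ≟ a))) ⟨
    ∑[ b < n ] (χ (in-part b) + χ (outside-part b) + χ (does (b ≟ a)))
      ≡⟨ sum-cong-≗ (λ b → χ-split (Aᵇ b) (does (b ≟ a)) (does (p a b ≟ p a v)) (≡a⇒∈ b)) ⟨
    count Aᵇ
      ≡⟨ ∣ A ∣≡count ⟨
    ∣ A ∣ ∎
    where
    open ≡-Reasoning
    in-part outside-part : Fin n → Bool
    in-part      b = Aᵇ b ∧ inPartOfV a b
    outside-part b = Aᵇ b ∧ outsidePartOfV a b
    ≡a⇒∈ : ∀ b → T (does (b ≟ a)) → T (Aᵇ b)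
    ≡a⇒∈ b b≡a rewrite T-does⁻ (b ≟ a) b≡a = ∈⇒T a∈A

  l^D≤1+#outsidePartOfV : ∀ a → l^D (p a) A a ≤ 1 + #outsidePartOfV a
  l^D≤1+#outsidePartOfV a = begin
    l^D (p a) A a
      ≡⟨ ∣tabulate∣≡count used ⟩
    count used
      ≤⟨ ∑-mono-≤ (λ i → χ≤χ+χ∧not (used i) (does (i ≟ p a v))) ⟩
    ∑[ i < k a ] (χ (does (i ≟ p a v)) + χ (used-elsewhere i))
      ≡⟨ ∑-distrib-+ (λ i → χ (does (i ≟ p a v))) (χ ∘ used-elsewhere) ⟩
    count (λ i → does (i ≟ p a v)) + count used-elsewhere
      ≡⟨ cong (_+ count used-elsewhere) (count-≟ (p a v)) ⟩
    1 + count used-elsewhere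
      ≤⟨ +-monoʳ-≤ 1 (count-image-≤ (p a) used-elsewhere (λ b → Aᵇ b ∧ outsidePartOfV a b) covered) ⟩
    1 + #outsidePartOfV a ∎
    where
    open ≤-Reasoning
    used used-elsewhere : Fin (k a) → Bool
    used i = does (any? λ b → (b ∈? A) ×-dec ((¬? (b ≟ a)) ×-dec (p a b ≟ i)))
    used-elsewhere i = used i ∧ not (does (i ≟ p a v))
    covered : ∀ i → T (used-elsewhere i) → ∃ λ b → T (Aᵇ b ∧ outsidePartOfV a b) × p a b ≡ i
    covered i t with to T-∧ t
    ... | u , i≢pav with T-does⁻ (any? λ b → (b ∈? A) ×-dec ((¬? (b ≟ a)) ×-dec (p a b ≟ i))) u
    ... | b , b∈A , b≢a , pab≡i = b , from T-∧ (∈⇒T b∈A , from T-∧ (T-not-does⁺ (b ≟ a) b≢a ,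
            T-not-does⁺ (p a b ≟ p a v) (T-not-does⁻ (i ≟ p a v) i≢pav ∘ trans (sym pab≡i)))) , pab≡i

  inPartOfV-witness : ∀ {a} → a ∈ A → 1 ≤ #inPartOfV a
    → ∃ λ b → b ∈ A × b ≢ a × Obstruction H c v a b
  inPartOfV-witness a∈A 1≤d with count-witness _ 1≤d
  ... | b , t with to T-∧ t
  ...   | Ab , ab = b , T⇒∈ Ab , proj₁ (inPartOfV⁻ ab) , inPartOfV⇒obstruction a∈A (T⇒∈ Ab) ab

2*l≤m+1 : ∀ {l d r m} → l ≤ 1 + r → d + r + 1 ≡ m → m ≤ 2 * d + 1 → 2 * l ≤ m + 1
2*l≤m+1 {l} {d} {r} l≤1+r refl m≤2d+1 = begin
  2 * l          ≤⟨ *-monoʳ-≤ 2 l≤1+r ⟩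
  2 * (1 + r)    ≡⟨ expand r ⟩
  r + r + 2      ≤⟨ +-monoˡ-≤ 2 (+-monoˡ-≤ r r≤d) ⟩
  d + r + 2      ≡⟨ +-assoc (d + r) 1 1 ⟨
  d + r + 1 + 1  ∎
  where
  open ≤-Reasoning
  r≤d : r ≤ d
  r≤d = +-cancelˡ-≤ d r d
    (≤-trans (+-cancelʳ-≤ 1 (d + r) (2 * d) m≤2d+1) (≤-reflexive (cong (d +_) (+-identityʳ d))))
  expand : ∀ r → 2 * (1 + r) ≡ r + r + 2
  expand = solve-∀

m≤2*d+1⇒1≤d : ∀ {m d} → 2 ≤ m → m ≤ 2 * d + 1 → 1 ≤ d
m≤2*d+1⇒1≤d {d = zero}  2≤m m≤1 = contradiction (≤-trans 2≤m m≤1) λ { (s≤s ()) }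
m≤2*d+1⇒1≤d {d = suc _} _   _   = s≤s z≤n

proposition2 : (H : Graph) (n : ℕ) (c : Coloring H n)
    → (∀ x y → c x y ≡ c y x)
    → (k : Fin n → ℕ) (p : (x : Fin n) → Fin n → Fin (k x))
    → (∀ x → IsCompleteMultipartite H c x (k x) (p x))
    → (A : Subset n) → Nonempty A
    → (v : Fin n) → v ∉ A
    → HDependent H c A v
    → ∃ λ a → a ∈ A
        × 2 * l^D (p a) A a ≤ ∣ A ∣ + 1
        × (2 ≤ ∣ A ∣ → ∃ λ a' → a' ∈ A × a' ≢ a × Obstruction H c v a a')
proposition2 H n c c-sym k p multipartite A nonempty v v∉A dependent =
  case large-#inPartOfV dependent nonempty of λ where
    (a , a∈A , m≤2d+1) → a , a∈A
      , 2*l≤m+1 (l^D≤1+#outsidePartOfV a) (#inPartOfV+#outsidePartOfV a∈A) m≤2d+1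
      , λ 2≤m → inPartOfV-witness a∈A (m≤2*d+1⇒1≤d 2≤m m≤2d+1)
  where open PartOfV H c c-sym multipartite A v v∉A
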